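{- If there is a proof in normal form of $M=_\omega N$, then for every term $X$ whose only free variable is $z$ there is a proof in normal form of $[M/z]X =_\omega [N/z]X$ of the same length (i.e. with the same number $t$ of $\omega$-rule conclusions in its chain).
   Context: $\mathcal{H}\omega$ proves equations $M=_\omega N$ between closed $\lambda$-terms from: Identity axioms $M=_\omega M$; weak conversion axioms $(\lambda x.U)N =_\omega [N/x]U$ and $[N/x]U=_\omega(\lambda x.U)N$ (closed $(\lambda x.U)N$), $M=_\omega\mathbf{\Omega}$ and $\mathbf{\Omega}=_\omega M$ (closed unsolvable $M$, where $\mathbf{\Omega}\equiv(\lambda x.xx)(\lambda x.xx)$); the Leibniz rule (from $[M/z]X=_\omega[M/z]Y$ and $M=_\omega N$, $X,Y$ with at most $z$ free, infer $[N/z]X=_\omega[N/z]Y$); and the $\omega$-rule (from $PM=_\omega QM$ for all closed $M$ infer $P=_\omega Q$). Proofs are well-founded trees. $\sim_{w\beta\Omega}$ is the least congruence containing the weak conversion axioms. A proof in normal form establishes $M=_\omega N$ through a chain $M\sim_{w\beta\Omega}M_1P_1$, $P_1=_\omega Q_1$, $M_1Q_1\sim_{w\beta\Omega}M_2P_2,\dots,P_t=_\omega Q_t$, $M_tQ_t\sim_{w\beta\Omega}N$ of Leibniz inferences, each $P_i=_\omega Q_i$ being the direct conclusion of an $\omega$-rule inference; for $t=0$ it is an Identity axiom or $M=_\omega N$ obtained from $M=_\omega M$ and $M\sim_{w\beta\Omega}N$. Its length is $t$. -}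

module Defs where

open import Data.Nat using (ℕ; zero; suc)
open import Data.Fin using (Fin; zero; suc)
open import Data.List using (List; foldl)
open import Data.Product using (∃)
open import Relation.Nullary using (¬_)

-- Well-scoped λ-terms (de Bruijn indices); Tm n = terms with free
-- variables among n.  Closed terms are Tm 0; a term "with at most z free"
-- is a Tm 1 (z = index zero).

data Tm (n : ℕ) : Set where
  var : Fin n → Tm n
  ƛ_  : Tm (suc n) → Tm n
  _·_ : Tm n → Tm n → Tm n

infixl 7 _·_
infix  6 ƛ_
infix  8 _[_]
infix  4 _→β_ _=β_ _=ω_ _∼wβΩ_

Closed : Set
Closed = Tm 0

ext : ∀ {m n} → (Fin m → Fin n) → Fin (suc m) → Fin (suc n)
ext ρ zero    = zero
ext ρ (suc i) = suc (ρ i)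

rename : ∀ {m n} → (Fin m → Fin n) → Tm m → Tm n
rename ρ (var i) = var (ρ i)
rename ρ (ƛ t)   = ƛ rename (ext ρ) t
rename ρ (t · u) = rename ρ t · rename ρ u

exts : ∀ {m n} → (Fin m → Tm n) → Fin (suc m) → Tm (suc n)
exts σ zero    = var zero
exts σ (suc i) = rename suc (σ i)

subst : ∀ {m n} → (Fin m → Tm n) → Tm m → Tm n
subst σ (var i) = σ i
subst σ (ƛ t)   = ƛ subst (exts σ) t
subst σ (t · u) = subst σ t · subst σ u

single : ∀ {n} → Tm n → Fin (suc n) → Tm n
single N zero    = N
single N (suc i) = var i

-- U [ N ] is [N/x]U, x being the outermost variable (index zero)
_[_] : ∀ {n} → Tm (suc n) → Tm n → Tm n
U [ N ] = subst (single N) U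

data _→β_ {n : ℕ} : Tm n → Tm n → Set where
  β    : ∀ (U : Tm (suc n)) N → (ƛ U) · N →β U [ N ]
  ξƛ   : ∀ {U U'} → U →β U' → ƛ U →β ƛ U'
  ξ·ˡ  : ∀ {A A' B} → A →β A' → A · B →β A' · B
  ξ·ʳ  : ∀ {A B B'} → B →β B' → A · B →β A · B'

data _=β_ {n : ℕ} : Tm n → Tm n → Set where
  βrefl  : ∀ {A} → A =β A
  βstep  : ∀ {A B} → A →β B → A =β B
  βsym   : ∀ {A B} → A =β B → B =β A
  βtrans : ∀ {A B C} → A =β B → B =β C → A =β C

I : Closed
I = ƛ var zero

Solvable : Closed → Set
Solvable M = ∃ λ (Ns : List Closed) → foldl _·_ M Ns =β I

Unsolvable : Closed → Set
Unsolvable M = ¬ Solvable M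

Ω : Closed
Ω = (ƛ var zero · var zero) · (ƛ var zero · var zero)

-- The system Hω (proofs are well-founded, possibly infinitely branching
-- trees: an inductive type with an infinitary ω-rule constructor).

data _=ω_ : Closed → Closed → Set where
  identity : ∀ M → M =ω M
  wβ       : ∀ (U : Tm 1) (N : Closed) → (ƛ U) · N =ω U [ N ]
  wβ⁻      : ∀ (U : Tm 1) (N : Closed) → U [ N ] =ω (ƛ U) · N
  wΩ       : ∀ M → Unsolvable M → M =ω Ω
  wΩ⁻      : ∀ M → Unsolvable M → Ω =ω M
  leibniz  : ∀ {M N} (X Y : Tm 1) → X [ M ] =ω Y [ M ] → M =ω N → X [ N ] =ω Y [ N ]
  ω-rule   : ∀ {P Q} → (∀ (M : Closed) → P · M =ω Q · M) → P =ω Q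

-- ∼wβΩ : least congruence (on closed terms, w.r.t. closed contexts
-- X with at most z free) containing the weak conversion axioms.

data _∼wβΩ_ : Closed → Closed → Set where
  ∼β     : ∀ (U : Tm 1) (N : Closed) → (ƛ U) · N ∼wβΩ U [ N ]
  ∼Ω     : ∀ M → Unsolvable M → M ∼wβΩ Ω
  ∼refl  : ∀ {M} → M ∼wβΩ M
  ∼sym   : ∀ {M N} → M ∼wβΩ N → N ∼wβΩ M
  ∼trans : ∀ {M N L} → M ∼wβΩ N → N ∼wβΩ L → M ∼wβΩ L
  ∼cong  : ∀ {M N} (X : Tm 1) → M ∼wβΩ N → X [ M ] ∼wβΩ X [ N ]

-- Proofs in normal form of length t:
--   M ∼ M₁[P₁],  P₁ =ω Q₁ (direct conclusion of an ω-rule inference,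
--   represented by its family of premises),  M₁[Q₁] ∼ M₂[P₂], …,
--   Mₜ[Qₜ] ∼ N.   For t = 0 : M ∼wβΩ N (covers the identity axiom).

data NormalProof : ℕ → Closed → Closed → Set where
  nf-zero : ∀ {M N} → M ∼wβΩ N → NormalProof 0 M N
  nf-step : ∀ {t M N} (C : Tm 1) (P Q : Closed)
            → M ∼wβΩ C [ P ]
            → (∀ (L : Closed) → P · L =ω Q · L)
            → NormalProof t (C [ Q ]) N
            → NormalProof (suc t) M N

-- Substituting into the context X commutes with the chain of a normal-form
-- proof: X[M] ∼ X[C₁[P₁]] = (X⟪C₁⟫)[P₁], so each link M ∼ C[P] is carried by
-- the composite context X⟪C⟫, the same ω-rule premises are reused, and the
-- length is unchanged.
module Submission where

open import Defs
open import Data.Nat using (ℕ; suc)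
open import Data.Fin using (Fin; zero; suc)
open import Function using (_∘_)
open import Relation.Binary.PropositionalEquality
  using (_≡_; _≗_; refl; sym; trans; cong; cong₂; subst₂)

rename-cong : ∀ {m n} {ρ ρ' : Fin m → Fin n} → ρ ≗ ρ' → rename ρ ≗ rename ρ'
rename-cong h (var i) = cong var (h i)
rename-cong h (ƛ t)   = cong ƛ_ (rename-cong (ext-cong h) t)
  where
  ext-cong : ∀ {m n} {ρ ρ' : Fin m → Fin n} → ρ ≗ ρ' → ext ρ ≗ ext ρ'
  ext-cong h zero    = refl
  ext-cong h (suc i) = cong suc (h i)
rename-cong h (t · u) = cong₂ _·_ (rename-cong h t) (rename-cong h u)

subst-cong : ∀ {m n} {σ σ' : Fin m → Tm n} → σ ≗ σ' → subst σ ≗ subst σ'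
subst-cong h (var i) = h i
subst-cong h (ƛ t)   = cong ƛ_ (subst-cong (exts-cong h) t)
  where
  exts-cong : ∀ {m n} {σ σ' : Fin m → Tm n} → σ ≗ σ' → exts σ ≗ exts σ'
  exts-cong h zero    = refl
  exts-cong h (suc i) = cong (rename suc) (h i)
subst-cong h (t · u) = cong₂ _·_ (subst-cong h t) (subst-cong h u)

ext-∘ : ∀ {k m n} (ρ : Fin m → Fin n) (ρ' : Fin k → Fin m) →
        ext ρ ∘ ext ρ' ≗ ext (ρ ∘ ρ')
ext-∘ ρ ρ' zero    = refl
ext-∘ ρ ρ' (suc i) = refl

rename-∘ : ∀ {k m n} (ρ : Fin m → Fin n) (ρ' : Fin k → Fin m) →
           rename ρ ∘ rename ρ' ≗ rename (ρ ∘ ρ')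
rename-∘ ρ ρ' (var i) = refl
rename-∘ ρ ρ' (ƛ t)   =
  cong ƛ_ (trans (rename-∘ (ext ρ) (ext ρ') t) (rename-cong (ext-∘ ρ ρ') t))
rename-∘ ρ ρ' (t · u) = cong₂ _·_ (rename-∘ ρ ρ' t) (rename-∘ ρ ρ' u)

exts-ext : ∀ {k m n} (σ : Fin m → Tm n) (ρ : Fin k → Fin m) →
           exts σ ∘ ext ρ ≗ exts (σ ∘ ρ)
exts-ext σ ρ zero    = refl
exts-ext σ ρ (suc i) = refl

subst-rename : ∀ {k m n} (σ : Fin m → Tm n) (ρ : Fin k → Fin m) →
               subst σ ∘ rename ρ ≗ subst (σ ∘ ρ)
subst-rename σ ρ (var i) = refl
subst-rename σ ρ (ƛ t)   =
  cong ƛ_ (trans (subst-rename (exts σ) (ext ρ) t) (subst-cong (exts-ext σ ρ) t))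
subst-rename σ ρ (t · u) = cong₂ _·_ (subst-rename σ ρ t) (subst-rename σ ρ u)

rename-exts : ∀ {k m n} (ρ : Fin m → Fin n) (σ : Fin k → Tm m) →
              rename (ext ρ) ∘ exts σ ≗ exts (rename ρ ∘ σ)
rename-exts ρ σ zero    = refl
rename-exts ρ σ (suc i) = trans (rename-∘ (ext ρ) suc (σ i)) (sym (rename-∘ suc ρ (σ i)))

rename-subst : ∀ {k m n} (ρ : Fin m → Fin n) (σ : Fin k → Tm m) →
               rename ρ ∘ subst σ ≗ subst (rename ρ ∘ σ)
rename-subst ρ σ (var i) = refl
rename-subst ρ σ (ƛ t)   =
  cong ƛ_ (trans (rename-subst (ext ρ) (exts σ) t) (subst-cong (rename-exts ρ σ) t))
rename-subst ρ σ (t · u) = cong₂ _·_ (rename-subst ρ σ t) (rename-subst ρ σ u)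

subst-exts : ∀ {k m n} (σ : Fin m → Tm n) (τ : Fin k → Tm m) →
             subst (exts σ) ∘ exts τ ≗ exts (subst σ ∘ τ)
subst-exts σ τ zero    = refl
subst-exts σ τ (suc i) = trans (subst-rename (exts σ) suc (τ i)) (sym (rename-subst suc σ (τ i)))

subst-∘ : ∀ {k m n} (σ : Fin m → Tm n) (τ : Fin k → Tm m) →
          subst σ ∘ subst τ ≗ subst (subst σ ∘ τ)
subst-∘ σ τ (var i) = refl
subst-∘ σ τ (ƛ t)   =
  cong ƛ_ (trans (subst-∘ (exts σ) (exts τ) t) (subst-cong (subst-exts σ τ) t))
subst-∘ σ τ (t · u) = cong₂ _·_ (subst-∘ σ τ t) (subst-∘ σ τ u)

_⟪_⟫ : ∀ {n} → Tm 1 → Tm n → Tm n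
X ⟪ C ⟫ = subst (λ _ → C) X

⟪⟫-[] : ∀ {n} (X : Tm 1) (C : Tm (suc n)) (P : Tm n) → X ⟪ C ⟫ [ P ] ≡ X ⟪ C [ P ] ⟫
⟪⟫-[] X C P = subst-∘ (single P) (λ _ → C) X

⟪⟫≡[] : ∀ (X : Tm 1) (N : Closed) → X ⟪ N ⟫ ≡ X [ N ]
⟪⟫≡[] X N = subst-cong fill X
  where
  fill : (λ (_ : Fin 1) → N) ≗ single N
  fill zero = refl

plug-⟪⟫ : ∀ (X C : Tm 1) (P : Closed) → X ⟪ C ⟫ [ P ] ≡ X [ C [ P ] ]
plug-⟪⟫ X C P = trans (⟪⟫-[] X C P) (⟪⟫≡[] X (C [ P ]))

lemma5p4 : ∀ (t : ℕ) (M N : Closed) → NormalProof t M N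
           → ∀ (X : Tm 1) → NormalProof t (X [ M ]) (X [ N ])
lemma5p4 .0 M N (nf-zero M∼N) X = nf-zero (∼cong X M∼N)
lemma5p4 (suc t) M N (nf-step C P Q M∼C[P] P=Q rest) X =
  nf-step (X ⟪ C ⟫) P Q X[M]∼XC[P] P=Q XC[Q]⇝X[N]
  where
  X[M]∼XC[P] : X [ M ] ∼wβΩ X ⟪ C ⟫ [ P ]
  X[M]∼XC[P] = subst₂ _∼wβΩ_ refl (sym (plug-⟪⟫ X C P)) (∼cong X M∼C[P])

  XC[Q]⇝X[N] : NormalProof t (X ⟪ C ⟫ [ Q ]) (X [ N ])
  XC[Q]⇝X[N] = subst₂ (NormalProof t) (sym (plug-⟪⟫ X C Q)) refl
                 (lemma5p4 t (C [ Q ]) N rest X)
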